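{- For $t\ge 0$ let $O^t$ denote the inclusion-maximal $t$-covered subtree of $\mathcal{T}$ containing $r$ (which is unique). Then for all $0\le t\le t'$ we have $O^t\subseteq O^{t'}$.
   Context: Setting: rooted tree $\mathcal{T}$ with root $r$, node weights $\ell_v>0$ for $v\neq r$, $\ell_r=0$, $\ell(Z)=\sum_{v\in Z}\ell_v$; a set of requests at nodes, all arriving at time $0$, each request $\rho$ at node $v_\rho$ with a non-negative non-decreasing waiting cost function $\omega_\rho$ with $\omega_\rho(0)=0$. For a node set $U$, $\omega(U,t)=\sum_{\rho:\,v_\rho\in U}\omega_\rho(t)$. A subtree is a connected node set; its root $r_Z$ is its node closest to $r$; $Z_x$ denotes the set of descendants of $x$ (including $x$) in $Z$. A subtree $Z$ is $t$-mature if $\omega(Z,t)\ge\ell(Z)$, and $t$-covered if $Z_x$ is $t$-mature for every $x\in Z$ with $x\neq r_Z$. The union of two $t$-covered subtrees containing $r$ is $t$-covered, so $O^t$ is well defined.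
   Formalization: The node weights $\ell_v$ and the times are rational, and each waiting cost function $\omega_\rho$ is a function from the rationals to the rationals. -}

module Defs where

open import Data.Nat using (ℕ; zero; suc) renaming (_≤_ to _≤ℕ_)
open import Data.Fin using (Fin; zero; suc; toℕ)
open import Data.Bool using (Bool; true; false; if_then_else_)
open import Data.Rational using (ℚ; 0ℚ; _+_; _≤_; _<_)
open import Data.Product using (Σ; ∃; _×_; _,_)
open import Data.Sum using (_⊎_)
open import Relation.Binary.PropositionalEquality using (_≡_; _≢_)
open import Function using (_∘_)

sumFin : ∀ {m} → (Fin m → ℚ) → ℚ
sumFin {zero}  f = 0ℚ
sumFin {suc m} f = f zero + sumFin (f ∘ suc)

-- A finite rooted tree on the nodes Fin (suc n); the root is 'zero'.
-- Node 'suc i' has parent 'parent i', whose index is smaller, so the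
-- parent relation is acyclic and every node reaches the root.

record Tree (n : ℕ) : Set where
  field
    parent    : Fin n → Fin (suc n)
    parent-lt : ∀ i → toℕ (parent i) ≤ℕ toℕ i

open Tree public

root : ∀ {n} → Fin (suc n)
root = zero

NodeSet : ℕ → Set
NodeSet n = Fin (suc n) → Bool

_∈_ : ∀ {n} → Fin (suc n) → NodeSet n → Set
v ∈ Z = Z v ≡ true

_⊆_ : ∀ {n} → NodeSet n → NodeSet n → Set
Z ⊆ W = ∀ v → v ∈ Z → v ∈ W

-- Desc T y x : y is a descendant of x (including y = x).
data Desc {n} (T : Tree n) : Fin (suc n) → Fin (suc n) → Set where
  here : ∀ {x} → Desc T x x
  up   : ∀ i {x} → Desc T (parent T i) x → Desc T (suc i) x

Adj : ∀ {n} → Tree n → Fin (suc n) → Fin (suc n) → Set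
Adj T a b = ∃ λ i → (a ≡ suc i × b ≡ parent T i) ⊎ (b ≡ suc i × a ≡ parent T i)

data Walk {n} (T : Tree n) (Z : NodeSet n) : Fin (suc n) → Fin (suc n) → Set where
  stay : ∀ {u} → u ∈ Z → Walk T Z u u
  step : ∀ {u w v} → u ∈ Z → Adj T u w → Walk T Z w v → Walk T Z u v

Subtree : ∀ {n} → Tree n → NodeSet n → Set
Subtree T Z = (∃ λ z → z ∈ Z) × (∀ u v → u ∈ Z → v ∈ Z → Walk T Z u v)

-- z is the root r_Z of Z: the node of Z closest to r, i.e. every node
-- of Z (connected) is a descendant of z.
IsSubtreeRoot : ∀ {n} → Tree n → NodeSet n → Fin (suc n) → Set
IsSubtreeRoot T Z z = z ∈ Z × (∀ y → y ∈ Z → Desc T y z)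

weight : ∀ {n} → (Fin n → ℚ) → Fin (suc n) → ℚ
weight ℓ zero    = 0ℚ
weight ℓ (suc i) = ℓ i

ℓset : ∀ {n} → (Fin n → ℚ) → NodeSet n → ℚ
ℓset ℓ Z = sumFin (λ v → if Z v then weight ℓ v else 0ℚ)

ωset : ∀ {n k} → (Fin k → Fin (suc n)) → (Fin k → ℚ → ℚ) → NodeSet n → ℚ → ℚ
ωset node cost U t = sumFin (λ j → if U (node j) then cost j t else 0ℚ)

ValidCost : (ℚ → ℚ) → Set
ValidCost f = (f 0ℚ ≡ 0ℚ)
            × (∀ t → 0ℚ ≤ t → 0ℚ ≤ f t)
            × (∀ t t' → 0ℚ ≤ t → t ≤ t' → f t ≤ f t')

module Setting {n k : ℕ} (T : Tree n) (ℓ : Fin n → ℚ)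
               (node : Fin k → Fin (suc n)) (cost : Fin k → ℚ → ℚ) where

  Mature : ℚ → NodeSet n → Set
  Mature t Z = ℓset ℓ Z ≤ ωset node cost Z t

  IsDescSet : NodeSet n → Fin (suc n) → NodeSet n → Set
  IsDescSet Z x W = ∀ y → (y ∈ W → y ∈ Z × Desc T y x) × (y ∈ Z × Desc T y x → y ∈ W)

  Covered : ℚ → NodeSet n → Set
  Covered t Z = ∀ x → x ∈ Z → (∀ z → IsSubtreeRoot T Z z → x ≢ z)
              → ∀ W → IsDescSet Z x W → Mature t W

  IsO : ℚ → NodeSet n → Set
  IsO t Z = Subtree T Z × root ∈ Z × Covered t Z
          × (∀ W → Subtree T W → root ∈ W → Covered t W → Z ⊆ W → W ⊆ Z)

-- Suppose a node y of O^t is missing from O^t' although its parent lies in O^t'.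
-- Graft the branch O^t_y onto O^t'. The result W is still a subtree through r, and it
-- is t'-covered: for x in the branch, W_x = O^t_x, which was already t-mature and
-- waiting costs only grow with time; for x in O^t' that is not an ancestor of y,
-- W_x = O^t'_x; for an ancestor x of y, W_x is the disjoint union of O^t'_x and O^t_y,
-- and maturity is additive over disjoint unions. This contradicts the maximality of
-- O^t', so induction along parent pointers from the root gives O^t ⊆ O^t'.

{-# OPTIONS --safe #-}
module Submission where

open import Defs
open import Data.Nat using (ℕ; suc)
open import Data.Fin using (Fin)
open import Data.Rational using (ℚ; 0ℚ; _≤_; _<_)

open import Level using (0ℓ)
open import Data.Nat using (zero; s≤s)
open import Data.Fin using (zero; suc)
import Data.Fin as Fin
open import Data.Fin.Induction using (<-wellFounded)
open import Data.Bool using (Bool; true; false; _∨_; _∧_; if_then_else_; _≟_)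
open import Data.Bool.Properties using (∨-zeroʳ)
open import Data.Rational using (_+_)
open import Data.Rational.Properties
  using (+-identityˡ; +-identityʳ; +-mono-≤; ≤-refl; ≤-trans; +-0-commutativeMonoid)
open import Algebra.Bundles using (CommutativeMonoid)
open import Algebra.Properties.CommutativeSemigroup
  (CommutativeMonoid.commutativeSemigroup +-0-commutativeMonoid) using (interchange)
open import Data.Product using (_×_; _,_; proj₁; proj₂)
open import Data.Sum using (_⊎_; inj₁; inj₂; [_,_]′)
open import Data.Empty using (⊥; ⊥-elim)
open import Function using (_∘_; case_of_)
open import Induction.WellFounded using (WfRec; module All)
open import Relation.Nullary using (Dec; yes; no; ¬_; does)
open import Relation.Nullary.Decidable using (dec-true)
open import Relation.Binary.PropositionalEquality
  using (_≡_; _≢_; _≗_; refl; sym; trans; cong; cong₂; subst₂; module ≡-Reasoning)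

sumFin-cong : ∀ {m} {f g : Fin m → ℚ} → f ≗ g → sumFin f ≡ sumFin g
sumFin-cong {zero}  f≗g = refl
sumFin-cong {suc m} f≗g = cong₂ _+_ (f≗g zero) (sumFin-cong (f≗g ∘ suc))

sumFin-mono : ∀ {m} {f g : Fin m → ℚ} → (∀ a → f a ≤ g a) → sumFin f ≤ sumFin g
sumFin-mono {zero}  f≤g = ≤-refl
sumFin-mono {suc m} f≤g = +-mono-≤ (f≤g zero) (sumFin-mono (f≤g ∘ suc))

sumFin-+ : ∀ {m} (f g : Fin m → ℚ) → sumFin (λ a → f a + g a) ≡ sumFin f + sumFin g
sumFin-+ {zero}  f g = sym (+-identityʳ 0ℚ)
sumFin-+ {suc m} f g = begin
  (f zero + g zero) + sumFin (λ a → f (suc a) + g (suc a))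
    ≡⟨ cong (f zero + g zero +_) (sumFin-+ (f ∘ suc) (g ∘ suc)) ⟩
  (f zero + g zero) + (sumFin (f ∘ suc) + sumFin (g ∘ suc))
    ≡⟨ interchange (f zero) (g zero) (sumFin (f ∘ suc)) (sumFin (g ∘ suc)) ⟩
  (f zero + sumFin (f ∘ suc)) + (g zero + sumFin (g ∘ suc))
    ∎
  where open ≡-Reasoning

-- Both ℓset and ωset are definitionally of this form.
sumOver : ∀ {m} → (Fin m → Bool) → (Fin m → ℚ) → ℚ
sumOver A g = sumFin (λ a → if A a then g a else 0ℚ)

module _ {m : ℕ} {g : Fin m → ℚ} where

  sumOver-cong : ∀ {A B : Fin m → Bool} → A ≗ B → sumOver A g ≡ sumOver B g
  sumOver-cong A≗B = sumFin-cong (λ a → cong (λ b → if b then g a else 0ℚ) (A≗B a))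

  sumOver-mono : ∀ (A : Fin m → Bool) {h : Fin m → ℚ} → (∀ a → g a ≤ h a)
               → sumOver A g ≤ sumOver A h
  sumOver-mono A {h} g≤h = sumFin-mono pointwise
    where
    pointwise : ∀ a → (if A a then g a else 0ℚ) ≤ (if A a then h a else 0ℚ)
    pointwise a with A a
    ... | true  = g≤h a
    ... | false = ≤-refl

  sumOver-∨ : ∀ (A B : Fin m → Bool) → (∀ a → A a ≡ true → B a ≡ true → ⊥)
            → sumOver (λ a → A a ∨ B a) g ≡ sumOver A g + sumOver B g
  sumOver-∨ A B disjoint = trans (sumFin-cong (λ a → split (A a) (B a) (disjoint a)))
                                 (sumFin-+ {m} _ _)
    where
    split : ∀ {a} b c → (b ≡ true → c ≡ true → ⊥)
          → (if b ∨ c then g a else 0ℚ) ≡ (if b then g a else 0ℚ) + (if c then g a else 0ℚ)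
    split true  true  b∩c = ⊥-elim (b∩c refl refl)
    split true  false _   = sym (+-identityʳ _)
    split false true  _   = sym (+-identityˡ _)
    split false false _   = sym (+-identityˡ 0ℚ)

module _ {n : ℕ} where

  infixr 22 _∪_

  -- Opaque (as is _↓_ below), so that the set expression survives in membership goals
  -- and the implicit arguments of the intro/elim lemmas can be inferred.
  opaque
    _∪_ : NodeSet n → NodeSet n → NodeSet n
    (A ∪ B) u = A u ∨ B u

    ∪-pointwise : ∀ A B → A ∪ B ≗ λ u → A u ∨ B u
    ∪-pointwise A B u = refl

    ∪-introˡ : ∀ {A B u} → u ∈ A → u ∈ A ∪ B
    ∪-introˡ {A} {B} {u} u∈A rewrite u∈A = refl

    ∪-introʳ : ∀ {A B u} → u ∈ B → u ∈ A ∪ B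
    ∪-introʳ {A} {B} {u} u∈B rewrite u∈B = ∨-zeroʳ (A u)

    ∪-elim : ∀ {A B u} → u ∈ A ∪ B → u ∈ A ⊎ u ∈ B
    ∪-elim {A} {B} {u} u∈A∪B with A u
    ... | true  = inj₁ refl
    ... | false = inj₂ u∈A∪B

  Disjoint : NodeSet n → NodeSet n → Set
  Disjoint A B = ∀ u → u ∈ A → u ∈ B → ⊥

  ⊆-antisym : ∀ {A B : NodeSet n} → A ⊆ B → B ⊆ A → A ≗ B
  ⊆-antisym A⊆B B⊆A u = same-truth (A⊆B u) (B⊆A u)
    where
    same-truth : ∀ {a b} → (a ≡ true → b ≡ true) → (b ≡ true → a ≡ true) → a ≡ b
    same-truth {true}          a⇒b _   = sym (a⇒b refl)
    same-truth {false} {true}  _   b⇒a = b⇒a refl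
    same-truth {false} {false} _   _   = refl

module Branches {n : ℕ} (T : Tree n) where

  parent-induction : (P : Fin (suc n) → Set) → P root → (∀ i → P (parent T i) → P (suc i))
                   → ∀ v → P v
  parent-induction P P-root P-suc = All.wfRec <-wellFounded 0ℓ P induct
    where
    induct : ∀ v → WfRec Fin._<_ P v → P v
    induct zero    _         = P-root
    induct (suc i) P-smaller = P-suc i (P-smaller (s≤s (parent-lt T i)))

  desc-to-root : ∀ v → Desc T v root
  desc-to-root = parent-induction (λ v → Desc T v root) here (λ i → up i)

  desc-from-root : ∀ {z} → Desc T root z → z ≡ root
  desc-from-root here = refl

  desc-trans : ∀ {u x y} → Desc T u x → Desc T x y → Desc T u y
  desc-trans here       x↓y = x↓y
  desc-trans (up i u↓x) x↓y = up i (desc-trans u↓x x↓y)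

  desc-comparable : ∀ {u x y} → Desc T u x → Desc T u y → Desc T x y ⊎ Desc T y x
  desc-comparable here       u↓y         = inj₁ u↓y
  desc-comparable (up i u↓x) here        = inj₂ (up i u↓x)
  desc-comparable (up i u↓x) (up .i u↓y) = desc-comparable u↓x u↓y

  desc? : ∀ y x → Dec (Desc T y x)
  desc? = parent-induction (λ y → ∀ x → Dec (Desc T y x)) desc-root? desc-suc?
    where
    desc-root? : ∀ x → Dec (Desc T root x)
    desc-root? x with x Fin.≟ root
    ... | yes refl = yes here
    ... | no  x≢r  = no (x≢r ∘ desc-from-root)
    desc-suc? : ∀ i → (∀ x → Dec (Desc T (parent T i) x)) → ∀ x → Dec (Desc T (suc i) x)
    desc-suc? i parent? x with suc i Fin.≟ x | parent? x
    ... | yes refl | _        = yes here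
    ... | no  _    | yes p↓x  = yes (up i p↓x)
    ... | no  i≢x  | no  p↛x = no λ { here → i≢x refl ; (up .i p↓x) → p↛x p↓x }

  infix 23 _↓_

  opaque
    _↓_ : NodeSet n → Fin (suc n) → NodeSet n
    (Z ↓ x) u = Z u ∧ does (desc? u x)

    ↓-intro : ∀ {Z x u} → u ∈ Z → Desc T u x → u ∈ Z ↓ x
    ↓-intro {Z} {x} {u} u∈Z u↓x rewrite u∈Z = dec-true (desc? u x) u↓x

    ↓-elim : ∀ {Z x u} → u ∈ Z ↓ x → u ∈ Z × Desc T u x
    ↓-elim {Z} {x} {u} u∈Z↓x with Z u | desc? u x | u∈Z↓x
    ... | true  | yes u↓x | _  = refl , u↓x
    ... | true  | no  _   | ()
    ... | false | _       | ()

  ParentClosed : NodeSet n → Set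
  ParentClosed Z = ∀ i → suc i ∈ Z → parent T i ∈ Z

  ancestor-∈ : ∀ {Z u y} → ParentClosed Z → u ∈ Z → Desc T u y → y ∈ Z
  ancestor-∈ closed u∈Z here       = u∈Z
  ancestor-∈ closed u∈Z (up i u↓y) = ancestor-∈ closed (closed i u∈Z) u↓y

  graft-parentClosed : ∀ {A Z i} → ParentClosed A → ParentClosed Z → parent T i ∈ A
                     → ParentClosed (A ∪ Z ↓ suc i)
  graft-parentClosed A-closed Z-closed p∈A j sj∈graft with ∪-elim sj∈graft
  ... | inj₁ sj∈A = ∪-introˡ (A-closed j sj∈A)
  ... | inj₂ sj∈Z↓si with ↓-elim sj∈Z↓si
  ...   | _    , here      = ∪-introˡ p∈A
  ...   | sj∈Z , up .j p↓si = ∪-introʳ (↓-intro (Z-closed j sj∈Z) p↓si)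

  module _ {Z : NodeSet n} where

    adj-sym : ∀ {a b} → Adj T a b → Adj T b a
    adj-sym (i , inj₁ e) = i , inj₂ e
    adj-sym (i , inj₂ e) = i , inj₁ e

    walk-head : ∀ {u v} → Walk T Z u v → u ∈ Z
    walk-head (stay u∈Z)     = u∈Z
    walk-head (step u∈Z _ _) = u∈Z

    walk-++ : ∀ {u v w} → Walk T Z u v → Walk T Z v w → Walk T Z u w
    walk-++ (stay _)           q = q
    walk-++ (step u∈Z u~w p) q = step u∈Z u~w (walk-++ p q)

    walk-reverse : ∀ {u v} → Walk T Z u v → Walk T Z v u
    walk-reverse (stay u∈Z)         = stay u∈Z
    walk-reverse (step u∈Z u~w p) =
      walk-++ (walk-reverse p) (step (walk-head p) (adj-sym u~w) (stay u∈Z))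

    exit-through-parent : ∀ {i u v} → Walk T Z u v → Desc T u (suc i) → ¬ Desc T v (suc i)
                        → parent T i ∈ Z
    exit-through-parent (stay _) u↓si v↛si = ⊥-elim (v↛si u↓si)
    exit-through-parent {i} (step {w = w} _ u~w p) u↓si v↛si with desc? w (suc i)
    ... | yes w↓si = exit-through-parent p w↓si v↛si
    ... | no  w↛si with u~w | u↓si
    ...   | j , inj₁ (refl , refl) | here        = walk-head p
    ...   | j , inj₁ (refl , refl) | up .j p↓si = ⊥-elim (w↛si p↓si)
    ...   | j , inj₂ (refl , refl) | p↓si        = ⊥-elim (w↛si (up j p↓si))

    rootedSubtree⇒parentClosed : Subtree T Z → root ∈ Z → ParentClosed Z
    rootedSubtree⇒parentClosed (_ , connected) r∈Z i si∈Z =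
      exit-through-parent (connected (suc i) root si∈Z r∈Z) here λ r↓si →
        case desc-from-root r↓si of λ ()

    walk-to-root : ParentClosed Z → ∀ v → v ∈ Z → Walk T Z v root
    walk-to-root closed = parent-induction (λ v → v ∈ Z → Walk T Z v root) stay
      λ i walk si∈Z → step si∈Z (i , inj₁ (refl , refl)) (walk (closed i si∈Z))

    parentClosed⇒rootedSubtree : ParentClosed Z → root ∈ Z → Subtree T Z
    parentClosed⇒rootedSubtree closed r∈Z =
      (root , r∈Z) ,
      λ u v u∈Z v∈Z →
        walk-++ (walk-to-root closed u u∈Z) (walk-reverse (walk-to-root closed v v∈Z))

  module Graft {A Z : NodeSet n} {y : Fin (suc n)}
               (A↛y : ∀ {u} → u ∈ A → ¬ Desc T u y) where

    graft↓-below : ∀ {x} → Desc T x y → Z ↓ x ≗ (A ∪ Z ↓ y) ↓ x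
    graft↓-below x↓y = ⊆-antisym
      (λ u u∈Z↓x → let u∈Z , u↓x = ↓-elim u∈Z↓x in
         ↓-intro (∪-introʳ (↓-intro u∈Z (desc-trans u↓x x↓y))) u↓x)
      (λ u u∈W↓x → let u∈W , u↓x = ↓-elim u∈W↓x in
         [ (λ u∈A → ⊥-elim (A↛y u∈A (desc-trans u↓x x↓y)))
         , (λ u∈Z↓y → ↓-intro (proj₁ (↓-elim u∈Z↓y)) u↓x)
         ]′ (∪-elim u∈W))

    graft↓-beside : ∀ {x} → x ∈ A → ¬ Desc T y x → A ↓ x ≗ (A ∪ Z ↓ y) ↓ x
    graft↓-beside x∈A y↛x = ⊆-antisym
      (λ u u∈A↓x → let u∈A , u↓x = ↓-elim u∈A↓x in ↓-intro (∪-introˡ u∈A) u↓x)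
      (λ u u∈W↓x → let u∈W , u↓x = ↓-elim u∈W↓x in
         [ (λ u∈A → ↓-intro u∈A u↓x)
         , (λ u∈Z↓y → let u↓y = proj₂ (↓-elim u∈Z↓y) in
              ⊥-elim ([ A↛y x∈A , y↛x ]′ (desc-comparable u↓x u↓y)))
         ]′ (∪-elim u∈W))

    graft↓-above : ∀ {x} → Desc T y x → A ↓ x ∪ Z ↓ y ≗ (A ∪ Z ↓ y) ↓ x
    graft↓-above y↓x = ⊆-antisym
      (λ u u∈A↓x∪Z↓y →
         [ (λ u∈A↓x → let u∈A , u↓x = ↓-elim u∈A↓x in
              ↓-intro (∪-introˡ u∈A) u↓x)
         , (λ u∈Z↓y → let u↓y = proj₂ (↓-elim u∈Z↓y) in
              ↓-intro (∪-introʳ u∈Z↓y) (desc-trans u↓y y↓x))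
         ]′ (∪-elim u∈A↓x∪Z↓y))
      (λ u u∈W↓x → let u∈W , u↓x = ↓-elim u∈W↓x in
         [ (λ u∈A → ∪-introˡ (↓-intro u∈A u↓x)) , ∪-introʳ ]′ (∪-elim u∈W))

    graft↓-disjoint : ∀ {x} → Disjoint (A ↓ x) (Z ↓ y)
    graft↓-disjoint u u∈A↓x u∈Z↓y = A↛y (proj₁ (↓-elim u∈A↓x)) (proj₂ (↓-elim u∈Z↓y))

module Covering {n k : ℕ} (T : Tree n) (ℓ : Fin n → ℚ)
                (node : Fin k → Fin (suc n)) (cost : Fin k → ℚ → ℚ) where
  open Branches T
  open Setting T ℓ node cost

  mature-resp-≗ : ∀ {t A B} → A ≗ B → Mature t A → Mature t B
  mature-resp-≗ {t} A≗B =
    subst₂ _≤_ (sumOver-cong {g = weight ℓ} A≗B)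
               (sumOver-cong {g = λ j → cost j t} (A≗B ∘ node))

  mature-∪ : ∀ {t A B} → Disjoint A B → Mature t A → Mature t B → Mature t (A ∪ B)
  mature-∪ {t} {A} {B} A∩B=∅ A-mature B-mature = mature-resp-≗ (sym ∘ ∪-pointwise A B)
    (subst₂ _≤_ (sym (sumOver-∨ {g = weight ℓ} A B A∩B=∅))
                (sym (sumOver-∨ {g = λ j → cost j t} _ _ (A∩B=∅ ∘ node)))
                (+-mono-≤ A-mature B-mature))

  mature-mono : (∀ j → ValidCost (cost j)) → ∀ {t t'} → 0ℚ ≤ t → t ≤ t'
              → ∀ Z → Mature t Z → Mature t' Z
  mature-mono valid 0≤t t≤t' Z Z-mature =
    ≤-trans Z-mature (sumOver-mono (Z ∘ node) λ j → proj₂ (proj₂ (valid j)) _ _ 0≤t t≤t')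

  ↓-isDescSet : ∀ Z x → IsDescSet Z x (Z ↓ x)
  ↓-isDescSet Z x u = ↓-elim , λ (u∈Z , u↓x) → ↓-intro u∈Z u↓x

  isDescSet⇒≗↓ : ∀ {Z x W} → IsDescSet Z x W → W ≗ Z ↓ x
  isDescSet⇒≗↓ W-desc = ⊆-antisym
    (λ u u∈W → let u∈Z , u↓x = proj₁ (W-desc u) u∈W in ↓-intro u∈Z u↓x)
    (λ u u∈Z↓x → proj₂ (W-desc u) (↓-elim u∈Z↓x))

  Covered↓ : ℚ → NodeSet n → Set
  Covered↓ t Z = ∀ x → x ∈ Z → x ≢ root → Mature t (Z ↓ x)

  subtreeRoot≡root : ∀ {Z z} → root ∈ Z → IsSubtreeRoot T Z z → z ≡ root
  subtreeRoot≡root r∈Z (_ , below-z) = desc-from-root (below-z root r∈Z)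

  covered⇒covered↓ : ∀ {t Z} → root ∈ Z → Covered t Z → Covered↓ t Z
  covered⇒covered↓ {Z = Z} r∈Z covered x x∈Z x≢r =
    covered x x∈Z (λ z z-root x≡z → x≢r (trans x≡z (subtreeRoot≡root r∈Z z-root)))
            (Z ↓ x) (↓-isDescSet Z x)

  covered↓⇒covered : ∀ {t Z} → root ∈ Z → Covered↓ t Z → Covered t Z
  covered↓⇒covered r∈Z covered x x∈Z x≢rZ W W-desc =
    mature-resp-≗ (sym ∘ isDescSet⇒≗↓ W-desc)
                  (covered x x∈Z (x≢rZ root (r∈Z , λ v _ → desc-to-root v)))

  module _ (valid : ∀ j → ValidCost (cost j))
           {t t' : ℚ} (0≤t : 0ℚ ≤ t) (t≤t' : t ≤ t') where

    graft-covered↓ : ∀ {Z Z' y} → (∀ {u} → u ∈ Z' → ¬ Desc T u y) → y ∈ Z → y ≢ root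
                   → Covered↓ t Z → Covered↓ t' Z' → Covered↓ t' (Z' ∪ Z ↓ y)
    graft-covered↓ {Z} {Z'} {y} Z'↛y y∈Z y≢r Z-cov Z'-cov x x∈W x≢r =
      [ on-host , in-branch ]′ (∪-elim x∈W)
      where
      open Graft {Z = Z} Z'↛y

      grow : ∀ A → Mature t A → Mature t' A
      grow = mature-mono valid 0≤t t≤t'

      in-branch : x ∈ Z ↓ y → Mature t' ((Z' ∪ Z ↓ y) ↓ x)
      in-branch x∈Z↓y = let x∈Z , x↓y = ↓-elim x∈Z↓y in
        mature-resp-≗ (graft↓-below x↓y) (grow (Z ↓ x) (Z-cov x x∈Z x≢r))

      on-host : x ∈ Z' → Mature t' ((Z' ∪ Z ↓ y) ↓ x)
      on-host x∈Z' with desc? y x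
      ... | no  y↛x = mature-resp-≗ (graft↓-beside x∈Z' y↛x) (Z'-cov x x∈Z' x≢r)
      ... | yes y↓x = mature-resp-≗ (graft↓-above y↓x)
        (mature-∪ graft↓-disjoint (Z'-cov x x∈Z' x≢r) (grow (Z ↓ y) (Z-cov y y∈Z y≢r)))

    graft-step : ∀ {Z Z'} → IsO t Z → IsO t' Z'
               → ∀ i → suc i ∈ Z → parent T i ∈ Z' → suc i ∈ Z'
    graft-step {Z} {Z'} (Z-sub , r∈Z , Z-cov , _) (Z'-sub , r∈Z' , Z'-cov , Z'-max) i si∈Z p∈Z'
      with Z' (suc i) ≟ true
    ... | yes si∈Z' = si∈Z'
    ... | no  si∉Z' =
      Z'-max W W-sub r∈W W-cov (λ _ → ∪-introˡ) (suc i) (∪-introʳ (↓-intro si∈Z here))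
      where
      W : NodeSet n
      W = Z' ∪ Z ↓ suc i

      Z'-closed : ParentClosed Z'
      Z'-closed = rootedSubtree⇒parentClosed Z'-sub r∈Z'

      Z'↛si : ∀ {u} → u ∈ Z' → ¬ Desc T u (suc i)
      Z'↛si u∈Z' u↓si = si∉Z' (ancestor-∈ Z'-closed u∈Z' u↓si)

      r∈W : root ∈ W
      r∈W = ∪-introˡ r∈Z'

      W-sub : Subtree T W
      W-sub = parentClosed⇒rootedSubtree
        (graft-parentClosed Z'-closed (rootedSubtree⇒parentClosed Z-sub r∈Z) p∈Z') r∈W

      W-cov : Covered t' W
      W-cov = covered↓⇒covered r∈W (graft-covered↓ Z'↛si si∈Z (λ ())
        (covered⇒covered↓ r∈Z Z-cov) (covered⇒covered↓ r∈Z' Z'-cov))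

mainTheorem8 : ∀ {n k} (T : Tree n) (ℓ : Fin n → ℚ) → (∀ i → 0ℚ < ℓ i)
    → (node : Fin k → Fin (suc n)) (cost : Fin k → ℚ → ℚ) → (∀ j → ValidCost (cost j))
    → ∀ t t' → 0ℚ ≤ t → t ≤ t'
    → ∀ Z Z' → Setting.IsO T ℓ node cost t Z → Setting.IsO T ℓ node cost t' Z'
    → Z ⊆ Z'
mainTheorem8 T ℓ _ node cost valid t t' 0≤t t≤t' Z Z' O-Z@(Z-sub , r∈Z , _) O-Z'@(_ , r∈Z' , _) =
  parent-induction (λ v → v ∈ Z → v ∈ Z') (λ _ → r∈Z') λ i p∈Z⇒p∈Z' si∈Z →
    graft-step valid 0≤t t≤t' O-Z O-Z' i si∈Z (p∈Z⇒p∈Z' (Z-closed i si∈Z))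
  where
  open Branches T
  open Covering T ℓ node cost
  Z-closed : ParentClosed Z
  Z-closed = rootedSubtree⇒parentClosed Z-sub r∈Z
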